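{- Let $\mathcal{F}$ be an axiomatically appropriate primitive term specification for $\mathsf{QLP}$. If $\mathsf{QLP}_{\mathcal{F}}\vdash F$, then there is a justification term $t$ such that $\mathsf{QLP}_{\mathcal{F}}\vdash t:F$.
   Context: Fix countably many justification variables, propositional variables, and primitive function symbols of each arity $n\ge0$ (arity $0$: constants); a primitive term is $f(x_1,\dots,x_n)$ with $f$ of arity $n$ and $x_i$ variables. Terms of $\mathsf{QLP}$: $t::= x\mid f(x_1,\dots,x_n)\mid t\cdot t\mid t+t\mid !t\mid(t\forall x)$, where $x$ is bound in $(t\forall x)$. Formulas: $A::= p\mid\bot\mid\neg A\mid A\wedge A\mid A\vee A\mid A\rightarrow A\mid t:A\mid(\forall x)A\mid(\exists x)A$, $x$ a justification variable. Axioms: all propositional tautologies; Q1: $(\forall x)A(x)\rightarrow A(t)$, $t$ free for $x$; Q2: $(\forall x)(A\rightarrow B(x))\rightarrow(A\rightarrow(\forall x)B(x))$, $x$ not free in $A$; Q3: $A(t)\rightarrow(\exists x)A(x)$, $t$ free for $x$; Q4: $(\forall x)(A(x)\rightarrow B)\rightarrow((\exists x)A(x)\rightarrow B)$, $x$ not free in $B$; jK: $s:(A\rightarrow B)\rightarrow(t:A\rightarrow(s\cdot t):B)$; jT: $t:A\rightarrow A$; j4: $t:A\rightarrow !t:t:A$; Sum: $s:A\rightarrow(s+t):A$, $s:A\rightarrow(t+s):A$; UF: $(\exists y)y:(\forall x)t:A\rightarrow(t\forall x):(\forall x)A$, $y$ not free in $t$ or $A$. Rules: Modus Ponens; Gen: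 from $A$ infer $(\forall x)A$; qNec: from $A$ infer $(\exists x)x:A$, $x$ not free in $A$; Axiom Necessitation (AN): from an axiom instance $A$ infer $f(x_1,\dots,x_n):A$ for a primitive term. A primitive term specification $\mathcal{F}$ is a set of formulas $f(x_1,\dots,x_n):A$ with $A$ an axiom instance of $\mathsf{QLP}$; it is axiomatically appropriate if for each axiom instance $A$ some $f(x_1,\dots,x_n):A\in\mathcal{F}$. $\mathsf{QLP}_{\mathcal{F}}$ is the logic in which AN only produces members of $\mathcal{F}$. -}

module Defs where

open import Data.Nat using (ℕ; _≡ᵇ_)
open import Data.Bool using (Bool; true; false; _∧_; _∨_; not; if_then_else_)
open import Data.Vec using (Vec)
open import Data.Product using (Σ; _×_; ∃-syntax; _,_)
open import Data.Maybe using (Maybe; just; nothing; _>>=_)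
open import Relation.Binary.PropositionalEquality using (_≡_)

JVar : Set
JVar = ℕ

data Term : Set where
  var  : JVar → Term
  prim : (n : ℕ) → ℕ → Vec JVar n → Term   -- f^n_i (x_1,...,x_n)
  _·_  : Term → Term → Term
  _⊕_  : Term → Term → Term
  !_   : Term → Term
  gen  : Term → JVar → Term                 -- (t ∀ x), binds x

data Formula : Set where
  atom : ℕ → Formula
  ⊥'   : Formula
  ¬'_  : Formula → Formula
  _∧'_ : Formula → Formula → Formula
  _∨'_ : Formula → Formula → Formula
  _⇒_  : Formula → Formula → Formula
  _∶_  : Term → Formula → Formula
  ∀'   : JVar → Formula → Formula
  ∃'   : JVar → Formula → Formula

infixr 5 _⇒_
infix 7 _∶_

memV : ∀ {n} → JVar → Vec JVar n → Bool
memV x Vec.[] = false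
memV x (y Vec.∷ ys) = (x ≡ᵇ y) ∨ memV x ys

freeT : JVar → Term → Bool
freeT x (var y) = x ≡ᵇ y
freeT x (prim n f ys) = memV x ys
freeT x (s · t) = freeT x s ∨ freeT x t
freeT x (s ⊕ t) = freeT x s ∨ freeT x t
freeT x (! t) = freeT x t
freeT x (gen t y) = not (x ≡ᵇ y) ∧ freeT x t

free : JVar → Formula → Bool
free x (atom p) = false
free x ⊥' = false
free x (¬' A) = free x A
free x (A ∧' B) = free x A ∨ free x B
free x (A ∨' B) = free x A ∨ free x B
free x (A ⇒ B) = free x A ∨ free x B
free x (t ∶ A) = freeT x t ∨ free x A
free x (∀' y A) = not (x ≡ᵇ y) ∧ free x A
free x (∃' y A) = not (x ≡ᵇ y) ∧ free x A

substVec : ∀ {n} → Vec JVar n → JVar → JVar → Vec JVar n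
substVec Vec.[] x z = Vec.[]
substVec (y Vec.∷ ys) x z = (if y ≡ᵇ x then z else y) Vec.∷ substVec ys x z

-- Substitution of the term u for the free occurrences of x (naive, i.e.
-- not capture-avoiding; it is used together with the freeFor side
-- condition, as in the usual textbook formulation).  Since primitive terms
-- f(x1,...,xn) only take variables as arguments, the result of substituting
-- a non-variable term for an argument variable is not a term of QLP; in that
-- case substitution is undefined (nothing), so A(t) simply does not exist.
substT : Term → JVar → Term → Maybe Term
substT (var y) x u = if y ≡ᵇ x then just u else just (var y)
substT (prim n f ys) x (var z) = just (prim n f (substVec ys x z))
substT (prim n f ys) x u = if memV x ys then nothing else just (prim n f ys)
substT (s · t) x u = substT s x u >>= λ s' → substT t x u >>= λ t' → just (s' · t')
substT (s ⊕ t) x u = substT s x u >>= λ s' → substT t x u >>= λ t' → just (s' ⊕ t')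
substT (! t) x u = substT t x u >>= λ t' → just (! t')
substT (gen t y) x u =
  if y ≡ᵇ x then just (gen t y) else (substT t x u >>= λ t' → just (gen t' y))

subst : Formula → JVar → Term → Maybe Formula
subst (atom p) x u = just (atom p)
subst ⊥' x u = just ⊥'
subst (¬' A) x u = subst A x u >>= λ A' → just (¬' A')
subst (A ∧' B) x u = subst A x u >>= λ A' → subst B x u >>= λ B' → just (A' ∧' B')
subst (A ∨' B) x u = subst A x u >>= λ A' → subst B x u >>= λ B' → just (A' ∨' B')
subst (A ⇒ B) x u = subst A x u >>= λ A' → subst B x u >>= λ B' → just (A' ⇒ B')
subst (t ∶ A) x u = substT t x u >>= λ t' → subst A x u >>= λ A' → just (t' ∶ A')
subst (∀' y A) x u =
  if y ≡ᵇ x then just (∀' y A) else (subst A x u >>= λ A' → just (∀' y A'))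
subst (∃' y A) x u =
  if y ≡ᵇ x then just (∃' y A) else (subst A x u >>= λ A' → just (∃' y A'))

-- u is free for x: no free occurrence of x lies in the scope of a binder
-- (quantifier ∀y/∃y or term binder (t ∀ y)) of a variable y free in u.
freeForT : Term → JVar → Term → Bool
freeForT u x (var y) = true
freeForT u x (prim n f ys) = true
freeForT u x (s · t) = freeForT u x s ∧ freeForT u x t
freeForT u x (s ⊕ t) = freeForT u x s ∧ freeForT u x t
freeForT u x (! t) = freeForT u x t
freeForT u x (gen t y) =
  not (freeT x (gen t y)) ∨ (not (freeT y u) ∧ freeForT u x t)

freeFor : Term → JVar → Formula → Bool
freeFor u x (atom p) = true
freeFor u x ⊥' = true
freeFor u x (¬' A) = freeFor u x A
freeFor u x (A ∧' B) = freeFor u x A ∧ freeFor u x B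
freeFor u x (A ∨' B) = freeFor u x A ∧ freeFor u x B
freeFor u x (A ⇒ B) = freeFor u x A ∧ freeFor u x B
freeFor u x (t ∶ A) = freeForT u x t ∧ freeFor u x A
freeFor u x (∀' y A) =
  not (free x (∀' y A)) ∨ (not (freeT y u) ∧ freeFor u x A)
freeFor u x (∃' y A) =
  not (free x (∃' y A)) ∨ (not (freeT y u) ∧ freeFor u x A)

-- Propositional tautologies: formulas true under every Boolean valuation
-- of their "propositional atoms" (propositional letters, t:A, (∀x)A, (∃x)A).
eval : (Formula → Bool) → Formula → Bool
eval v ⊥' = false
eval v (¬' A) = not (eval v A)
eval v (A ∧' B) = eval v A ∧ eval v B
eval v (A ∨' B) = eval v A ∨ eval v B
eval v (A ⇒ B) = not (eval v A) ∨ eval v B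
eval v A = v A

Tautology : Formula → Set
Tautology A = (v : Formula → Bool) → eval v A ≡ true

data IsAxiom : Formula → Set where
  taut : ∀ {A} → Tautology A → IsAxiom A
  Q1 : ∀ x A t B → subst A x t ≡ just B → freeFor t x A ≡ true →
       IsAxiom (∀' x A ⇒ B)
  Q2 : ∀ x A B → free x A ≡ false →
       IsAxiom (∀' x (A ⇒ B) ⇒ (A ⇒ ∀' x B))
  Q3 : ∀ x A t B → subst A x t ≡ just B → freeFor t x A ≡ true →
       IsAxiom (B ⇒ ∃' x A)
  Q4 : ∀ x A B → free x B ≡ false →
       IsAxiom (∀' x (A ⇒ B) ⇒ (∃' x A ⇒ B))
  jK : ∀ s t A B → IsAxiom (s ∶ (A ⇒ B) ⇒ (t ∶ A ⇒ (s · t) ∶ B))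
  jT : ∀ t A → IsAxiom (t ∶ A ⇒ A)
  j4 : ∀ t A → IsAxiom (t ∶ A ⇒ (! t) ∶ (t ∶ A))
  Sumˡ : ∀ s t A → IsAxiom (s ∶ A ⇒ (s ⊕ t) ∶ A)
  Sumʳ : ∀ s t A → IsAxiom (s ∶ A ⇒ (t ⊕ s) ∶ A)
  UF : ∀ x y t A → freeT y t ≡ false → free y A ≡ false →
       IsAxiom (∃' y (var y ∶ ∀' x (t ∶ A)) ⇒ (gen t x) ∶ ∀' x A)

record PrimSpec : Set₁ where
  field
    mem   : Formula → Set
    shape : ∀ φ → mem φ →
            ∃[ n ] ∃[ f ] ∃[ xs ] ∃[ A ] (φ ≡ (prim n f xs ∶ A) × IsAxiom A)
open PrimSpec public

AxiomaticallyAppropriate : PrimSpec → Set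
AxiomaticallyAppropriate 𝓕 =
  ∀ A → IsAxiom A → ∃[ n ] ∃[ f ] ∃[ xs ] mem 𝓕 (prim n f xs ∶ A)

data _⊢_ (𝓕 : PrimSpec) : Formula → Set where
  ax   : ∀ {A} → IsAxiom A → 𝓕 ⊢ A
  mp   : ∀ {A B} → 𝓕 ⊢ (A ⇒ B) → 𝓕 ⊢ A → 𝓕 ⊢ B
  gen  : ∀ {A} x → 𝓕 ⊢ A → 𝓕 ⊢ ∀' x A
  qnec : ∀ {A} x → free x A ≡ false → 𝓕 ⊢ A → 𝓕 ⊢ ∃' x (var x ∶ A)
  an   : ∀ {A n f xs} → IsAxiom A → mem 𝓕 (prim n f xs ∶ A) →
         𝓕 ⊢ (prim n f xs ∶ A)

infix 3 _⊢_

module Submission where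

-- The proof is by
-- induction on the derivation of F, each rule mirrored by a term operation:
--   * axiom A             ↦ the primitive term that 𝓕 assigns to A;
--   * modus ponens        ↦ application s · t   (axiom jK);
--   * generalization ∀x   ↦ (t ∀ x)              (qNec for a fresh y, then UF);
--   * qNec ∃x x:A         ↦ c · !t, where c justifies the Q3 instance
--                           t:A → (∃x) x:A       (axioms j4 and jK);
--   * axiom necessitation ↦ !f(x⃗)                (axiom j4).
-- Two syntactic facts are needed first: substituting for a variable that is
-- not free changes nothing (to build the Q3 instance), and every formula has
-- a variable that is not free in it (the fresh y in the generalization case).

open import Defs
open import Data.Product using (∃-syntax; _,_)
open import Data.Nat using (ℕ; zero; suc; _≡ᵇ_; _+_; _≤_; s≤s)
open import Data.Nat.Properties using (m+n≤o⇒m≤o; m+n≤o⇒n≤o; m≤m+n; m≤n+m)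
open import Data.Bool using (false; true; _∨_; _∧_; not)
open import Data.Bool.Properties using (∨-conicalˡ; ∨-conicalʳ; ∧-zeroʳ)
open import Data.Vec using (Vec; []; _∷_)
open import Data.Maybe using (just)
open import Relation.Binary.PropositionalEquality using (_≡_; refl; cong; cong₂; trans)

-- Boolean equality on variables is symmetric and reflexive; the definitions
-- of free and subst test the same equality in opposite orders.
≡ᵇ-sym : ∀ x y → (x ≡ᵇ y) ≡ (y ≡ᵇ x)
≡ᵇ-sym zero    zero    = refl
≡ᵇ-sym zero    (suc y) = refl
≡ᵇ-sym (suc x) zero    = refl
≡ᵇ-sym (suc x) (suc y) = ≡ᵇ-sym x y

≡ᵇ-refl : ∀ x → (x ≡ᵇ x) ≡ true
≡ᵇ-refl zero    = refl
≡ᵇ-refl (suc x) = ≡ᵇ-refl x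

>⇒≢ᵇ : ∀ x y → suc x ≤ y → (y ≡ᵇ x) ≡ false
>⇒≢ᵇ zero    (suc y) _       = refl
>⇒≢ᵇ (suc x) (suc y) (s≤s p) = >⇒≢ᵇ x y p

substVec-nonfree : ∀ {n} (ys : Vec JVar n) x z → memV x ys ≡ false →
                   substVec ys x z ≡ ys
substVec-nonfree []       x z _ = refl
substVec-nonfree (y ∷ ys) x z e
  rewrite ≡ᵇ-sym y x | ∨-conicalˡ (x ≡ᵇ y) _ e =
  cong (y ∷_) (substVec-nonfree ys x z (∨-conicalʳ _ (memV x ys) e))

substT-nonfree : ∀ t x u → freeT x t ≡ false → substT t x u ≡ just t
substT-nonfree (var y) x u e rewrite ≡ᵇ-sym y x | e = refl
substT-nonfree (prim n f ys) x (var z) e rewrite substVec-nonfree ys x z e = refl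
substT-nonfree (prim n f ys) x (prim _ _ _) e rewrite e = refl
substT-nonfree (prim n f ys) x (_ · _) e rewrite e = refl
substT-nonfree (prim n f ys) x (_ ⊕ _) e rewrite e = refl
substT-nonfree (prim n f ys) x (! _) e rewrite e = refl
substT-nonfree (prim n f ys) x (gen _ _) e rewrite e = refl
substT-nonfree (s · t) x u e
  rewrite substT-nonfree s x u (∨-conicalˡ _ (freeT x t) e)
        | substT-nonfree t x u (∨-conicalʳ (freeT x s) _ e) = refl
substT-nonfree (s ⊕ t) x u e
  rewrite substT-nonfree s x u (∨-conicalˡ _ (freeT x t) e)
        | substT-nonfree t x u (∨-conicalʳ (freeT x s) _ e) = refl
substT-nonfree (! t) x u e rewrite substT-nonfree t x u e = refl
substT-nonfree (gen t y) x u e with y ≡ᵇ x in y≟x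
... | true  = refl
... | false rewrite ≡ᵇ-sym x y | y≟x | substT-nonfree t x u e = refl

subst-nonfree : ∀ A x u → free x A ≡ false → subst A x u ≡ just A
subst-nonfree (atom p) x u e = refl
subst-nonfree ⊥' x u e = refl
subst-nonfree (¬' A) x u e rewrite subst-nonfree A x u e = refl
subst-nonfree (A ∧' B) x u e
  rewrite subst-nonfree A x u (∨-conicalˡ _ (free x B) e)
        | subst-nonfree B x u (∨-conicalʳ (free x A) _ e) = refl
subst-nonfree (A ∨' B) x u e
  rewrite subst-nonfree A x u (∨-conicalˡ _ (free x B) e)
        | subst-nonfree B x u (∨-conicalʳ (free x A) _ e) = refl
subst-nonfree (A ⇒ B) x u e
  rewrite subst-nonfree A x u (∨-conicalˡ _ (free x B) e)
        | subst-nonfree B x u (∨-conicalʳ (free x A) _ e) = refl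
subst-nonfree (t ∶ A) x u e
  rewrite substT-nonfree t x u (∨-conicalˡ _ (free x A) e)
        | subst-nonfree A x u (∨-conicalʳ (freeT x t) _ e) = refl
subst-nonfree (∀' y A) x u e with y ≡ᵇ x in y≟x
... | true  = refl
... | false rewrite ≡ᵇ-sym x y | y≟x | subst-nonfree A x u e = refl
subst-nonfree (∃' y A) x u e with y ≡ᵇ x in y≟x
... | true  = refl
... | false rewrite ≡ᵇ-sym x y | y≟x | subst-nonfree A x u e = refl

freeForT-nonfree : ∀ t x u → freeT x t ≡ false → freeForT u x t ≡ true
freeForT-nonfree (var y) x u e = refl
freeForT-nonfree (prim n f ys) x u e = refl
freeForT-nonfree (s · t) x u e
  rewrite freeForT-nonfree s x u (∨-conicalˡ _ (freeT x t) e)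
        | freeForT-nonfree t x u (∨-conicalʳ (freeT x s) _ e) = refl
freeForT-nonfree (s ⊕ t) x u e
  rewrite freeForT-nonfree s x u (∨-conicalˡ _ (freeT x t) e)
        | freeForT-nonfree t x u (∨-conicalʳ (freeT x s) _ e) = refl
freeForT-nonfree (! t) x u e = freeForT-nonfree t x u e
freeForT-nonfree (gen t y) x u e rewrite e = refl

freeFor-nonfree : ∀ A x u → free x A ≡ false → freeFor u x A ≡ true
freeFor-nonfree (atom p) x u e = refl
freeFor-nonfree ⊥' x u e = refl
freeFor-nonfree (¬' A) x u e = freeFor-nonfree A x u e
freeFor-nonfree (A ∧' B) x u e
  rewrite freeFor-nonfree A x u (∨-conicalˡ _ (free x B) e)
        | freeFor-nonfree B x u (∨-conicalʳ (free x A) _ e) = refl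
freeFor-nonfree (A ∨' B) x u e
  rewrite freeFor-nonfree A x u (∨-conicalˡ _ (free x B) e)
        | freeFor-nonfree B x u (∨-conicalʳ (free x A) _ e) = refl
freeFor-nonfree (A ⇒ B) x u e
  rewrite freeFor-nonfree A x u (∨-conicalˡ _ (free x B) e)
        | freeFor-nonfree B x u (∨-conicalʳ (free x A) _ e) = refl
freeFor-nonfree (t ∶ A) x u e
  rewrite freeForT-nonfree t x u (∨-conicalˡ _ (free x A) e)
        | freeFor-nonfree A x u (∨-conicalʳ (freeT x t) _ e) = refl
freeFor-nonfree (∀' y A) x u e rewrite e = refl
freeFor-nonfree (∃' y A) x u e rewrite e = refl

-- Fresh variables: boundT t (boundF A) is a number such that no variable
-- at or above it occurs free in t (in A).  It sums suc y over the variable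
-- occurrences y, which is crude but makes the bound additive.

boundV : ∀ {n} → Vec JVar n → ℕ
boundV []       = 0
boundV (y ∷ ys) = suc y + boundV ys

boundT : Term → ℕ
boundT (var y)       = suc y
boundT (prim n f ys) = boundV ys
boundT (s · t)       = boundT s + boundT t
boundT (s ⊕ t)       = boundT s + boundT t
boundT (! t)         = boundT t
boundT (gen t y)     = boundT t

boundF : Formula → ℕ
boundF (atom p) = 0
boundF ⊥'       = 0
boundF (¬' A)   = boundF A
boundF (A ∧' B) = boundF A + boundF B
boundF (A ∨' B) = boundF A + boundF B
boundF (A ⇒ B)  = boundF A + boundF B
boundF (t ∶ A)  = boundT t + boundF A
boundF (∀' y A) = boundF A
boundF (∃' y A) = boundF A

boundV-fresh : ∀ {n} (ys : Vec JVar n) y → boundV ys ≤ y → memV y ys ≡ false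
boundV-fresh []       y _ = refl
boundV-fresh (x ∷ ys) y p =
  cong₂ _∨_ (>⇒≢ᵇ x y (m+n≤o⇒m≤o (suc x) p))
            (boundV-fresh ys y (m+n≤o⇒n≤o (suc x) p))

boundT-fresh : ∀ t y → boundT t ≤ y → freeT y t ≡ false
boundT-fresh (var x) y p = >⇒≢ᵇ x y p
boundT-fresh (prim n f ys) y p = boundV-fresh ys y p
boundT-fresh (s · t) y p =
  cong₂ _∨_ (boundT-fresh s y (m+n≤o⇒m≤o (boundT s) p))
            (boundT-fresh t y (m+n≤o⇒n≤o (boundT s) p))
boundT-fresh (s ⊕ t) y p =
  cong₂ _∨_ (boundT-fresh s y (m+n≤o⇒m≤o (boundT s) p))
            (boundT-fresh t y (m+n≤o⇒n≤o (boundT s) p))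
boundT-fresh (! t) y p = boundT-fresh t y p
boundT-fresh (gen t x) y p =
  trans (cong (not (y ≡ᵇ x) ∧_) (boundT-fresh t y p)) (∧-zeroʳ _)

boundF-fresh : ∀ A y → boundF A ≤ y → free y A ≡ false
boundF-fresh (atom _) y p = refl
boundF-fresh ⊥' y p = refl
boundF-fresh (¬' A) y p = boundF-fresh A y p
boundF-fresh (A ∧' B) y p =
  cong₂ _∨_ (boundF-fresh A y (m+n≤o⇒m≤o (boundF A) p))
            (boundF-fresh B y (m+n≤o⇒n≤o (boundF A) p))
boundF-fresh (A ∨' B) y p =
  cong₂ _∨_ (boundF-fresh A y (m+n≤o⇒m≤o (boundF A) p))
            (boundF-fresh B y (m+n≤o⇒n≤o (boundF A) p))
boundF-fresh (A ⇒ B) y p =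
  cong₂ _∨_ (boundF-fresh A y (m+n≤o⇒m≤o (boundF A) p))
            (boundF-fresh B y (m+n≤o⇒n≤o (boundF A) p))
boundF-fresh (t ∶ A) y p =
  cong₂ _∨_ (boundT-fresh t y (m+n≤o⇒m≤o (boundT t) p))
            (boundF-fresh A y (m+n≤o⇒n≤o (boundT t) p))
boundF-fresh (∀' x A) y p =
  trans (cong (not (y ≡ᵇ x) ∧_) (boundF-fresh A y p)) (∧-zeroʳ _)
boundF-fresh (∃' x A) y p =
  trans (cong (not (y ≡ᵇ x) ∧_) (boundF-fresh A y p)) (∧-zeroʳ _)

module _ {𝓕 : PrimSpec} where

  apply : ∀ {s t A B} → 𝓕 ⊢ s ∶ (A ⇒ B) → 𝓕 ⊢ t ∶ A → 𝓕 ⊢ (s · t) ∶ B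
  apply {s} {t} {A} {B} d e = mp (mp (ax (jK s t A B)) d) e

  check : ∀ {t A} → 𝓕 ⊢ t ∶ A → 𝓕 ⊢ (! t) ∶ (t ∶ A)
  check {t} {A} d = mp (ax (j4 t A)) d

  -- Uniform generalization: from t:A infer (t∀x):(∀x)A.  Pick y fresh for
  -- (∀x) t:A, apply qNec to (∀x) t:A to get (∃y) y:(∀x) t:A, then use UF.
  generalize : ∀ {t A} x → 𝓕 ⊢ t ∶ A → 𝓕 ⊢ gen t x ∶ ∀' x A
  generalize {t} {A} x d =
    mp (ax (UF x y t A y∉t y∉A)) (qnec y y∉∀t∶A (gen x d))
    where
      y = boundT t + boundF A
      y∉t = boundT-fresh t y (m≤m+n (boundT t) (boundF A))
      y∉A = boundF-fresh A y (m≤n+m (boundF A) (boundT t))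
      y∉∀t∶A : free y (∀' x (t ∶ A)) ≡ false
      y∉∀t∶A = trans (cong (not (y ≡ᵇ x) ∧_) (cong₂ _∨_ y∉t y∉A)) (∧-zeroʳ _)

module _ {𝓕 : PrimSpec} (appropriate : AxiomaticallyAppropriate 𝓕) where

  justify-axiom : ∀ {A} → IsAxiom A → ∃[ t ] (𝓕 ⊢ t ∶ A)
  justify-axiom {A} a with appropriate A a
  ... | n , f , xs , f∶A = prim n f xs , an a f∶A

  -- If x is not free in A, then t:A → (∃x) x:A is a Q3 instance (substitute
  -- t for x in x:A); so from t:A we get c·!t:(∃x) x:A for its justification c.
  witness : ∀ {t A} x → free x A ≡ false → 𝓕 ⊢ t ∶ A →
            ∃[ u ] (𝓕 ⊢ u ∶ ∃' x (var x ∶ A))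
  witness {t} {A} x x∉A d with justify-axiom (Q3 x (var x ∶ A) t (t ∶ A) instance-eq
                                                 (freeFor-nonfree A x t x∉A))
    where
      instance-eq : subst (var x ∶ A) x t ≡ just (t ∶ A)
      instance-eq rewrite ≡ᵇ-refl x | subst-nonfree A x t x∉A = refl
  ... | c , dc = c · (! t) , apply dc (check d)

lemma10 : (𝓕 : PrimSpec) → AxiomaticallyAppropriate 𝓕 →
            ∀ F → 𝓕 ⊢ F → ∃[ t ] (𝓕 ⊢ t ∶ F)
lemma10 𝓕 ap F (ax a) = justify-axiom ap a
lemma10 𝓕 ap F (mp d e) with lemma10 𝓕 ap _ d | lemma10 𝓕 ap _ e
... | s , ds | t , dt = s · t , apply ds dt
lemma10 𝓕 ap _ (gen x d) with lemma10 𝓕 ap _ d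
... | t , dt = gen t x , generalize x dt
lemma10 𝓕 ap _ (qnec x x∉A d) with lemma10 𝓕 ap _ d
... | t , dt = witness ap x x∉A dt
lemma10 𝓕 ap _ (an a f∶A) = ! _ , check (an a f∶A)
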